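{- Let $p\neq q$ be primes, $d\geq 1$, $\gamma\in\mathbb{F}_p\setminus\{0\}$ and $t\in\mathbb{F}_p$. Then there exist coefficients $\beta_{t,r}\in\mathbb{F}_q$ ($r\in\mathbb{F}_p$) such that for all $x_1,\dots,x_d\in\{0,1\}$ and all $y\in\mathbb{F}_p$, \[\mathbf{b}(\gamma x_1\cdots x_d+y;t)=\mathbf{b}(y;t)+\sum_{r\in\mathbb{F}_p}\beta_{t,r}\sum_{S\subseteq[d]}(-1)^{|S|}\,\mathbf{b}\Big(\gamma\sum_{i\in S}x_i+y;\,r\Big),\] where both sides are computed in $\mathbb{F}_q$.
   Context: For $z,r\in\mathbb{F}_p$, $\mathbf{b}(z;r)\in\{0,1\}\subseteq\mathbb{F}_q$ equals $1$ if $z=r$ and $0$ otherwise. Arithmetic inside $\mathbf{b}$ is in $\mathbb{F}_p$ (with $x_i\in\{0,1\}\subseteq\mathbb{F}_p$). $[d]=\{1,\dots,d\}$. -}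

module Defs where

open import Data.Nat as ℕ using (ℕ; zero; suc; _%_)
open import Data.Nat.Properties using (_≟_)
open import Data.Integer as ℤ using (ℤ; +_; 0ℤ; 1ℤ; -1ℤ)
open import Data.Integer.Divisibility using (_∣_)
open import Data.Fin using (Fin; toℕ)
open import Data.Fin.Subset using (Subset; inside; outside; ∣_∣)
open import Data.Vec using (Vec; []; _∷_; lookup)
open import Data.List using (List; []; _∷_; map; _++_; allFin)
open import Data.Nat.ListAction using (sum; product)
open import Relation.Nullary using (yes; no)

red : ℕ → ℕ → ℕ
red zero    z = z
red (suc k) z = z % suc k

-- b(z;r) for z, r ∈ F_p (given by natural-number representatives):
-- 1 if z = r in F_p, 0 otherwise; valued in ℤ (its image in F_q is 0 or 1).
𝐛 : (p : ℕ) → ℕ → ℕ → ℤ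
𝐛 p z r with red p z ≟ red p r
... | yes _ = 1ℤ
... | no  _ = 0ℤ

_≡[mod_]_ : ℤ → ℕ → ℤ → Set
a ≡[mod q ] b = (+ q) ∣ (a ℤ.- b)

Σ[_]_ : (p : ℕ) → (Fin p → ℤ) → ℤ
Σ[ p ] f = Data.List.foldr ℤ._+_ 0ℤ (map f (allFin p))
  where import Data.List

allSubsets : (d : ℕ) → List (Subset d)
allSubsets zero    = [] ∷ []
allSubsets (suc d) = map (outside ∷_) (allSubsets d) ++ map (inside ∷_) (allSubsets d)

ΣS : (d : ℕ) → (Subset d → ℤ) → ℤ
ΣS d f = Data.List.foldr ℤ._+_ 0ℤ (map f (allSubsets d))
  where import Data.List

sign : ℕ → ℤ
sign zero    = 1ℤ
sign (suc k) = -1ℤ ℤ.* sign k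

sumOver : {d : ℕ} → Subset d → (Fin d → Fin 2) → ℕ
sumOver {d} S x = sum (map (λ i → f (lookup S i) (toℕ (x i))) (allFin d))
  where
  open import Data.Bool using (Bool; true; false)
  f : Bool → ℕ → ℕ
  f true  n = n
  f false _ = 0

prodAll : {d : ℕ} → (Fin d → Fin 2) → ℕ
prodAll {d} x = product (map (λ i → toℕ (x i)) (allFin d))

-- Write P = x₁⋯x_d, Δ f (z) = f z - f (γ + z) and h = b(·;t). For P ∈ {0,1} the left-hand side
-- is h y - P Δh(y), while for B = Σ_r β_r b(·;r) the alternating subset sum on the right is
-- P Δ^d B(y). Taking β_r ≡ g(r) (mod q) for a p-periodic g makes B ≡ g, so it suffices to find
-- a p-periodic g with Δ^d g ≡ -Δh (mod q). On p-periodic functions the weighted orbit sum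
-- W u (z) = Σ_{k<p} (k+1) u(z + kγ) satisfies Δ(W u) = C u - p u, where the orbit sum
-- C u (z) = Σ_{k<p} u(z + kγ) has Δ(C u) = 0. Hence Δ^(e+1) (W^e h) = (-p)^e Δh, and
-- g = -(-m)^e W^e h works for d = e + 1, where m p ≡ 1 (mod q) exists since p ≠ q are prime.
module Submission where

open import Defs
open import Data.Nat using (ℕ; zero; suc; _+_; _*_; _%_; _≥_; _≟_; NonZero)
open import Data.Nat.Properties
  using (+-comm; +-assoc; *-comm; *-zeroʳ; *-identityˡ; *-identityʳ; *-distribˡ-+; <-cmp; +-commutativeSemigroup)
open import Data.Nat.DivMod using (_/_; _mod_; m%n<n; m<n⇒m%n≡m; [m+n]%n≡m%n; m≡m%n+[m/n]*n)
open import Data.Nat.Primality using (Prime; prime⇒nonZero)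
open import Data.Nat.Coprimality as Coprimality using (Coprime; prime⇒coprime; coprime-Bézout)
open import Data.Nat.GCD using (module Bézout)
open import Data.Nat.ListAction using (sum; product)
open import Data.Integer using (ℤ; +_; _-_; -_; 0ℤ; 1ℤ; -1ℤ; _^_) renaming (_+_ to _+ℤ_; _*_ to _*ℤ_)
import Data.Integer.Properties as ℤₚ
open import Data.Integer.Divisibility.Signed using (_∣_; divides; ∣⇒∣ᵤ; ∣m∣n⇒∣m+n; ∣m∣n⇒∣m-n; ∣m⇒∣-m; ∣n⇒∣m*n)
open import Data.Integer.DivMod using (_%ℕ_; _/ℕ_; n%ℕd<d; a≡a%ℕn+[a/ℕn]*n)
open import Data.Integer.Tactic.RingSolver using (solve-∀)
open import Algebra.Properties.CommutativeSemigroup +-commutativeSemigroup using (x∙yz≈y∙xz; xy∙z≈y∙xz)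
open import Algebra.Properties.CommutativeSemigroup ℤₚ.+-commutativeSemigroup
  using () renaming (interchange to +-interchange)
open import Algebra.Properties.CommutativeSemigroup ℤₚ.*-commutativeSemigroup
  using () renaming (interchange to *-interchange)
open import Data.Fin as Fin using (Fin; toℕ)
open import Data.Fin.Properties using (toℕ-fromℕ<; toℕ<n; toℕ-injective) renaming (suc-injective to suc-injectiveᶠ)
open import Data.Fin.Subset using (Subset; inside; outside; ∣_∣)
open import Data.Vec using (_∷_)
open import Data.List using (List; []; _∷_; map; _++_; foldr; tabulate; allFin)
open import Data.List.Properties using (map-tabulate)
open import Data.Product using (∃; _,_; proj₁; proj₂)
open import Data.Sum as Sum using (_⊎_; inj₁; inj₂)
open import Data.Empty using (⊥-elim)
open import Function using (_∘_; id)
open import Relation.Nullary using (yes; no)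
open import Relation.Binary.Bundles using (Setoid)
open import Relation.Binary.Definitions using (tri<; tri≈; tri>)
open import Relation.Binary.PropositionalEquality
  using (_≡_; _≢_; refl; sym; trans; cong; cong₂; module ≡-Reasoning)
import Relation.Binary.Reasoning.Setoid as SetoidReasoning

-- Σ[ p ] f and ΣS d f unfold to sumOf (allFin p) f and sumOf (allSubsets d) f.
sumOf : {A : Set} → List A → (A → ℤ) → ℤ
sumOf xs f = foldr _+ℤ_ 0ℤ (map f xs)

module _ {A : Set} where

  sumOf-cong : (xs : List A) {f g : A → ℤ} → (∀ a → f a ≡ g a) → sumOf xs f ≡ sumOf xs g
  sumOf-cong []       f≗g = refl
  sumOf-cong (x ∷ xs) f≗g = cong₂ _+ℤ_ (f≗g x) (sumOf-cong xs f≗g)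

  sumOf-zero : (xs : List A) → sumOf xs (λ _ → 0ℤ) ≡ 0ℤ
  sumOf-zero []       = refl
  sumOf-zero (x ∷ xs) = trans (ℤₚ.+-identityˡ _) (sumOf-zero xs)

  sumOf-+ : (xs : List A) (f g : A → ℤ) → sumOf xs (λ a → f a +ℤ g a) ≡ sumOf xs f +ℤ sumOf xs g
  sumOf-+ []       f g = refl
  sumOf-+ (x ∷ xs) f g = trans (cong (f x +ℤ g x +ℤ_) (sumOf-+ xs f g)) (+-interchange (f x) (g x) _ _)

  sumOf-*ˡ : (xs : List A) (c : ℤ) (f : A → ℤ) → c *ℤ sumOf xs f ≡ sumOf xs (λ a → c *ℤ f a)
  sumOf-*ˡ []       c f = ℤₚ.*-zeroʳ c
  sumOf-*ˡ (x ∷ xs) c f = trans (ℤₚ.*-distribˡ-+ c (f x) _) (cong (c *ℤ f x +ℤ_) (sumOf-*ˡ xs c f))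

  sumOf-++ : (xs ys : List A) (f : A → ℤ) → sumOf (xs ++ ys) f ≡ sumOf xs f +ℤ sumOf ys f
  sumOf-++ []       ys f = sym (ℤₚ.+-identityˡ _)
  sumOf-++ (x ∷ xs) ys f = trans (cong (f x +ℤ_) (sumOf-++ xs ys f)) (sym (ℤₚ.+-assoc (f x) _ _))

  sumOf-map : {B : Set} (xs : List B) (g : B → A) (f : A → ℤ) → sumOf (map g xs) f ≡ sumOf xs (f ∘ g)
  sumOf-map []       g f = refl
  sumOf-map (x ∷ xs) g f = cong (f (g x) +ℤ_) (sumOf-map xs g f)

sumOf-++-map : {A B : Set} (xs : List B) (g g′ : B → A) (f : A → ℤ) →
               sumOf (map g xs ++ map g′ xs) f ≡ sumOf xs (λ b → f (g b) +ℤ f (g′ b))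
sumOf-++-map xs g g′ f = begin
  sumOf (map g xs ++ map g′ xs) f                ≡⟨ sumOf-++ (map g xs) (map g′ xs) f ⟩
  sumOf (map g xs) f +ℤ sumOf (map g′ xs) f      ≡⟨ cong₂ _+ℤ_ (sumOf-map xs g f) (sumOf-map xs g′ f) ⟩
  sumOf xs (f ∘ g) +ℤ sumOf xs (f ∘ g′)          ≡⟨ sumOf-+ xs (f ∘ g) (f ∘ g′) ⟨
  sumOf xs (λ b → f (g b) +ℤ f (g′ b))           ∎
  where open ≡-Reasoning

sumOf-comm : {A B : Set} (xs : List A) (ys : List B) (K : A → B → ℤ) →
             sumOf xs (λ a → sumOf ys (K a)) ≡ sumOf ys (λ b → sumOf xs (λ a → K a b))
sumOf-comm []       ys K = sym (sumOf-zero ys)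
sumOf-comm (x ∷ xs) ys K =
  trans (cong (sumOf ys (K x) +ℤ_) (sumOf-comm xs ys K)) (sym (sumOf-+ ys (K x) _))

sumOf-interchange : {A B : Set} (xs : List A) (ys : List B) (u : A → ℤ) (v : B → ℤ) (K : A → B → ℤ) →
  sumOf xs (λ a → u a *ℤ sumOf ys (λ b → v b *ℤ K a b)) ≡ sumOf ys (λ b → v b *ℤ sumOf xs (λ a → u a *ℤ K a b))
sumOf-interchange xs ys u v K = begin
  sumOf xs (λ a → u a *ℤ sumOf ys (λ b → v b *ℤ K a b))   ≡⟨ sumOf-cong xs (λ a → sumOf-*ˡ ys (u a) _) ⟩
  sumOf xs (λ a → sumOf ys (λ b → u a *ℤ (v b *ℤ K a b))) ≡⟨ sumOf-cong xs (λ a → sumOf-cong ys (λ b → swap (u a) (v b) (K a b))) ⟩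
  sumOf xs (λ a → sumOf ys (λ b → v b *ℤ (u a *ℤ K a b))) ≡⟨ sumOf-comm xs ys _ ⟩
  sumOf ys (λ b → sumOf xs (λ a → v b *ℤ (u a *ℤ K a b))) ≡⟨ sumOf-cong ys (λ b → sumOf-*ˡ xs (v b) _) ⟨
  sumOf ys (λ b → v b *ℤ sumOf xs (λ a → u a *ℤ K a b))   ∎
  where
  open ≡-Reasoning
  swap : ∀ x y z → x *ℤ (y *ℤ z) ≡ y *ℤ (x *ℤ z)
  swap = solve-∀

map-tabulate-suc : {A : Set} {n : ℕ} (g : Fin (suc n) → A) → map g (tabulate Fin.suc) ≡ map (g ∘ Fin.suc) (allFin n)
map-tabulate-suc g = trans (map-tabulate Fin.suc g) (sym (map-tabulate id (g ∘ Fin.suc)))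

sumOf-allFin-suc : {n : ℕ} (f : Fin (suc n) → ℤ) → sumOf (allFin (suc n)) f ≡ f Fin.zero +ℤ sumOf (allFin n) (f ∘ Fin.suc)
sumOf-allFin-suc {n} f = cong (λ xs → f Fin.zero +ℤ foldr _+ℤ_ 0ℤ xs) (map-tabulate-suc {n = n} f)

sumOf-allFin-single : {n : ℕ} (f : Fin n → ℤ) (i : Fin n) → (∀ r → r ≢ i → f r ≡ 0ℤ) → sumOf (allFin n) f ≡ f i
sumOf-allFin-single {suc n} f Fin.zero vanish = begin
  sumOf (allFin (suc n)) f                      ≡⟨ sumOf-allFin-suc f ⟩
  f Fin.zero +ℤ sumOf (allFin n) (f ∘ Fin.suc)  ≡⟨ cong (f Fin.zero +ℤ_) (sumOf-cong (allFin n) (λ r → vanish (Fin.suc r) (λ ()))) ⟩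
  f Fin.zero +ℤ sumOf (allFin n) (λ _ → 0ℤ)     ≡⟨ cong (f Fin.zero +ℤ_) (sumOf-zero (allFin n)) ⟩
  f Fin.zero +ℤ 0ℤ                              ≡⟨ ℤₚ.+-identityʳ (f Fin.zero) ⟩
  f Fin.zero                                    ∎
  where open ≡-Reasoning
sumOf-allFin-single {suc n} f (Fin.suc i) vanish = begin
  sumOf (allFin (suc n)) f                      ≡⟨ sumOf-allFin-suc f ⟩
  f Fin.zero +ℤ sumOf (allFin n) (f ∘ Fin.suc)  ≡⟨ cong (_+ℤ sumOf (allFin n) (f ∘ Fin.suc)) (vanish Fin.zero (λ ())) ⟩
  0ℤ +ℤ sumOf (allFin n) (f ∘ Fin.suc)          ≡⟨ ℤₚ.+-identityˡ _ ⟩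
  sumOf (allFin n) (f ∘ Fin.suc)                ≡⟨ sumOf-allFin-single (f ∘ Fin.suc) i (λ r r≢i → vanish (Fin.suc r) (r≢i ∘ suc-injectiveᶠ)) ⟩
  f (Fin.suc i)                                 ∎
  where open ≡-Reasoning

+-minus-interchange : ∀ a b c d → a +ℤ b - (c +ℤ d) ≡ a - c +ℤ (b - d)
+-minus-interchange = solve-∀

∑< : ℕ → (ℕ → ℤ) → ℤ
∑< zero    F = 0ℤ
∑< (suc n) F = ∑< n F +ℤ F n

∑<-cong : ∀ n {F G : ℕ → ℤ} → (∀ k → F k ≡ G k) → ∑< n F ≡ ∑< n G
∑<-cong zero    F≗G = refl
∑<-cong (suc n) F≗G = cong₂ _+ℤ_ (∑<-cong n F≗G) (F≗G n)

∑<-+ : ∀ n (F G : ℕ → ℤ) → ∑< n (λ k → F k +ℤ G k) ≡ ∑< n F +ℤ ∑< n G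
∑<-+ zero    F G = refl
∑<-+ (suc n) F G = trans (cong (_+ℤ (F n +ℤ G n)) (∑<-+ n F G)) (+-interchange (∑< n F) (∑< n G) (F n) (G n))

∑<-- : ∀ n (F G : ℕ → ℤ) → ∑< n F - ∑< n G ≡ ∑< n (λ k → F k - G k)
∑<-- zero    F G = refl
∑<-- (suc n) F G = trans (+-minus-interchange (∑< n F) (F n) (∑< n G) (G n)) (cong (_+ℤ (F n - G n)) (∑<-- n F G))

∑<-telescope : ∀ n (F : ℕ → ℤ) → ∑< n (λ k → F k - F (suc k)) ≡ F 0 - F n
∑<-telescope zero    F = sym (ℤₚ.+-inverseʳ (F 0))
∑<-telescope (suc n) F = trans (cong (_+ℤ (F n - F (suc n))) (∑<-telescope n F)) (ℤₚ.+-minus-telescope (F 0) (F n) (F (suc n)))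

Δ : ℕ → (ℕ → ℤ) → ℕ → ℤ
Δ a f z = f z - f (a + z)

Δ^ : ℕ → ℕ → (ℕ → ℤ) → ℕ → ℤ
Δ^ a zero    f = f
Δ^ a (suc j) f = Δ^ a j (Δ a f)

module _ (a : ℕ) where

  Δ^-cong : ∀ j {f g : ℕ → ℤ} → (∀ z → f z ≡ g z) → ∀ z → Δ^ a j f z ≡ Δ^ a j g z
  Δ^-cong zero    f≗g = f≗g
  Δ^-cong (suc j) f≗g = Δ^-cong j (λ z → cong₂ _-_ (f≗g z) (f≗g (a + z)))

  Δ^-zero : ∀ j {f : ℕ → ℤ} → (∀ z → f z ≡ 0ℤ) → ∀ z → Δ^ a j f z ≡ 0ℤ
  Δ^-zero zero    f≗0 = f≗0
  Δ^-zero (suc j) f≗0 = Δ^-zero j (λ z → cong₂ _-_ (f≗0 z) (f≗0 (a + z)))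

  Δ^-+ : ∀ j (f g : ℕ → ℤ) z → Δ^ a j (λ w → f w +ℤ g w) z ≡ Δ^ a j f z +ℤ Δ^ a j g z
  Δ^-+ zero    f g z = refl
  Δ^-+ (suc j) f g z =
    trans (Δ^-cong j (λ w → +-minus-interchange (f w) (g w) (f (a + w)) (g (a + w))) z) (Δ^-+ j (Δ a f) (Δ a g) z)

  Δ^-*ˡ : ∀ j (c : ℤ) (f : ℕ → ℤ) z → Δ^ a j (λ w → c *ℤ f w) z ≡ c *ℤ Δ^ a j f z
  Δ^-*ˡ zero    c f z = refl
  Δ^-*ˡ (suc j) c f z = trans (Δ^-cong j (λ w → distribˡ-minus c (f w) (f (a + w))) z) (Δ^-*ˡ j c (Δ a f) z)
    where
    distribˡ-minus : ∀ c x y → c *ℤ x - c *ℤ y ≡ c *ℤ (x - y)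
    distribˡ-minus = solve-∀

Periodic : ℕ → (ℕ → ℤ) → Set
Periodic n f = ∀ z → f (n + z) ≡ f z

module _ {n : ℕ} {f : ℕ → ℤ} (f-periodic : Periodic n f) where

  periodic-* : ∀ k z → f (k * n + z) ≡ f z
  periodic-* zero    z = refl
  periodic-* (suc k) z = trans (cong f (+-assoc n (k * n) z)) (trans (f-periodic _) (periodic-* k z))

  periodic-% : .{{_ : NonZero n}} → ∀ z → f (z % n) ≡ f z
  periodic-% z = begin
    f (z % n)                 ≡⟨ periodic-* (z / n) (z % n) ⟨
    f (z / n * n + z % n)     ≡⟨ cong f (+-comm (z / n * n) (z % n)) ⟩
    f (z % n + z / n * n)     ≡⟨ cong f (m≡m%n+[m/n]*n z n) ⟨
    f z                       ∎
    where open ≡-Reasoning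

module _ (n a : ℕ) where

  orbitSum : (ℕ → ℤ) → ℕ → ℤ
  orbitSum u z = ∑< n (λ k → u (k * a + z))

  weightedOrbitSum : (ℕ → ℤ) → ℕ → ℤ
  weightedOrbitSum u z = ∑< n (λ k → + suc k *ℤ u (k * a + z))

  weightedOrbitSum^ : ℕ → (ℕ → ℤ) → ℕ → ℤ
  weightedOrbitSum^ zero    u = u
  weightedOrbitSum^ (suc j) u = weightedOrbitSum (weightedOrbitSum^ j u)

  private
    step-along-orbit : ∀ k z → k * a + (a + z) ≡ suc k * a + z
    step-along-orbit k z = sym (xy∙z≈y∙xz a (k * a) z)

    orbit-closes : {u : ℕ → ℤ} → Periodic n u → ∀ z → u (n * a + z) ≡ u z
    orbit-closes {u} u-periodic z = trans (cong (λ k → u (k + z)) (*-comm n a)) (periodic-* u-periodic a z)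

  weightedOrbitSum^-periodic : ∀ j {u : ℕ → ℤ} → Periodic n u → Periodic n (weightedOrbitSum^ j u)
  weightedOrbitSum^-periodic zero    u-periodic = u-periodic
  weightedOrbitSum^-periodic (suc j) {u} u-periodic z =
    ∑<-cong n (λ k → cong (+ suc k *ℤ_) (trans (cong w (x∙yz≈y∙xz (k * a) n z)) (w-periodic _)))
    where
    w : ℕ → ℤ
    w = weightedOrbitSum^ j u
    w-periodic : Periodic n w
    w-periodic = weightedOrbitSum^-periodic j u-periodic

  Δ-orbitSum : {u : ℕ → ℤ} → Periodic n u → ∀ z → Δ a (orbitSum u) z ≡ 0ℤ
  Δ-orbitSum {u} u-periodic z = begin
    orbitSum u z - orbitSum u (a + z)                     ≡⟨ cong (λ v → orbitSum u z - v) (∑<-cong n (λ k → cong u (step-along-orbit k z))) ⟩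
    orbitSum u z - ∑< n (λ k → F (suc k))                 ≡⟨ ∑<-- n F (F ∘ suc) ⟩
    ∑< n (λ k → F k - F (suc k))                          ≡⟨ ∑<-telescope n F ⟩
    u z - u (n * a + z)                                   ≡⟨ cong (λ v → u z - v) (orbit-closes u-periodic z) ⟩
    u z - u z                                             ≡⟨ ℤₚ.+-inverseʳ (u z) ⟩
    0ℤ                                                    ∎
    where
    open ≡-Reasoning
    F : ℕ → ℤ
    F k = u (k * a + z)

  -- The weights telescope: (k+1)(F k - F (k+1)) = F k + (k F k - (k+1) F (k+1)).
  Δ-weightedOrbitSum : {u : ℕ → ℤ} → Periodic n u → ∀ z → Δ a (weightedOrbitSum u) z ≡ orbitSum u z +ℤ (- + n) *ℤ u z
  Δ-weightedOrbitSum {u} u-periodic z = begin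
    weightedOrbitSum u z - weightedOrbitSum u (a + z)
      ≡⟨ cong (λ v → weightedOrbitSum u z - v) (∑<-cong n (λ k → cong (λ w → + suc k *ℤ u w) (step-along-orbit k z))) ⟩
    weightedOrbitSum u z - ∑< n (λ k → + suc k *ℤ F (suc k))
      ≡⟨ ∑<-- n _ _ ⟩
    ∑< n (λ k → + suc k *ℤ F k - + suc k *ℤ F (suc k))
      ≡⟨ ∑<-cong n (λ k → split (+ k) (F k) (F (suc k))) ⟩
    ∑< n (λ k → F k +ℤ (+ k *ℤ F k - + suc k *ℤ F (suc k)))
      ≡⟨ ∑<-+ n F _ ⟩
    orbitSum u z +ℤ ∑< n (λ k → W k - W (suc k))
      ≡⟨ cong (orbitSum u z +ℤ_) (∑<-telescope n W) ⟩
    orbitSum u z +ℤ (0ℤ *ℤ F 0 - + n *ℤ F n)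
      ≡⟨ cong (λ v → orbitSum u z +ℤ (0ℤ *ℤ F 0 - + n *ℤ v)) (orbit-closes u-periodic z) ⟩
    orbitSum u z +ℤ (0ℤ *ℤ F 0 - + n *ℤ u z)
      ≡⟨ cong (orbitSum u z +ℤ_) (vanish-first (F 0) (+ n) (u z)) ⟩
    orbitSum u z +ℤ (- + n) *ℤ u z
      ∎
    where
    open ≡-Reasoning
    F : ℕ → ℤ
    F k = u (k * a + z)
    W : ℕ → ℤ
    W k = + k *ℤ F k
    split : ∀ k x y → (1ℤ +ℤ k) *ℤ x - (1ℤ +ℤ k) *ℤ y ≡ x +ℤ (k *ℤ x - (1ℤ +ℤ k) *ℤ y)
    split = solve-∀
    vanish-first : ∀ x m y → 0ℤ *ℤ x - m *ℤ y ≡ (- m) *ℤ y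
    vanish-first = solve-∀

  Δ^-weightedOrbitSum^ : ∀ j {v : ℕ → ℤ} → Periodic n v → ∀ z →
                         Δ^ a (suc j) (weightedOrbitSum^ j v) z ≡ (- + n) ^ j *ℤ Δ a v z
  Δ^-weightedOrbitSum^ zero    v-periodic z = sym (ℤₚ.*-identityˡ _)
  Δ^-weightedOrbitSum^ (suc j) {v} v-periodic z = begin
    Δ^ a (suc j) (Δ a (weightedOrbitSum w)) z
      ≡⟨ Δ^-cong a (suc j) (Δ-weightedOrbitSum w-periodic) z ⟩
    Δ^ a (suc j) (λ y → orbitSum w y +ℤ (- + n) *ℤ w y) z
      ≡⟨ Δ^-+ a (suc j) (orbitSum w) _ z ⟩
    Δ^ a j (Δ a (orbitSum w)) z +ℤ Δ^ a (suc j) (λ y → (- + n) *ℤ w y) z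
      ≡⟨ cong₂ _+ℤ_ (Δ^-zero a j (Δ-orbitSum w-periodic) z) (Δ^-*ˡ a (suc j) (- + n) w z) ⟩
    0ℤ +ℤ (- + n) *ℤ Δ^ a (suc j) w z
      ≡⟨ ℤₚ.+-identityˡ _ ⟩
    (- + n) *ℤ Δ^ a (suc j) w z
      ≡⟨ cong ((- + n) *ℤ_) (Δ^-weightedOrbitSum^ j v-periodic z) ⟩
    (- + n) *ℤ ((- + n) ^ j *ℤ Δ a v z)
      ≡⟨ ℤₚ.*-assoc (- + n) _ _ ⟨
    (- + n) ^ suc j *ℤ Δ a v z
      ∎
    where
    open ≡-Reasoning
    w : ℕ → ℤ
    w = weightedOrbitSum^ j v
    w-periodic : Periodic n w
    w-periodic = weightedOrbitSum^-periodic j v-periodic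

module Congruence (q : ℕ) where

  infix 4 _≈_
  record _≈_ (a b : ℤ) : Set where
    constructor divisible
    field ≈⇒∣ : + q ∣ a - b

  open _≈_

  ≈⇒≡[mod] : ∀ {a b} → a ≈ b → a ≡[mod q ] b
  ≈⇒≡[mod] = ∣⇒∣ᵤ ∘ ≈⇒∣

  private
    ∣⇒≈ : ∀ {a b c} → + q ∣ c → c ≡ a - b → a ≈ b
    ∣⇒≈ q∣c refl = divisible q∣c

  ≈-reflexive : ∀ {a b} → a ≡ b → a ≈ b
  ≈-reflexive {a} refl = ∣⇒≈ (divides 0ℤ refl) (sym (ℤₚ.+-inverseʳ a))

  ≈-refl : ∀ {a} → a ≈ a
  ≈-refl = ≈-reflexive refl

  ≈-sym : ∀ {a b} → a ≈ b → b ≈ a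
  ≈-sym {a} {b} a≈b = ∣⇒≈ (∣m⇒∣-m (≈⇒∣ a≈b)) (neg-minus a b)
    where
    neg-minus : ∀ a b → - (a - b) ≡ b - a
    neg-minus = solve-∀

  ≈-trans : ∀ {a b c} → a ≈ b → b ≈ c → a ≈ c
  ≈-trans {a} {b} {c} a≈b b≈c = ∣⇒≈ (∣m∣n⇒∣m+n (≈⇒∣ a≈b) (≈⇒∣ b≈c)) (ℤₚ.+-minus-telescope a b c)

  ≈-setoid : Setoid _ _
  ≈-setoid = record
    { Carrier       = ℤ
    ; _≈_           = _≈_
    ; isEquivalence = record { refl = ≈-refl ; sym = ≈-sym ; trans = ≈-trans }
    }

  +-cong : ∀ {a b c d} → a ≈ b → c ≈ d → a +ℤ c ≈ b +ℤ d
  +-cong {a} {b} {c} {d} a≈b c≈d = ∣⇒≈ (∣m∣n⇒∣m+n (≈⇒∣ a≈b) (≈⇒∣ c≈d)) (sym (+-minus-interchange a c b d))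

  minus-cong : ∀ {a b c d} → a ≈ b → c ≈ d → a - c ≈ b - d
  minus-cong {a} {b} {c} {d} a≈b c≈d = ∣⇒≈ (∣m∣n⇒∣m-n (≈⇒∣ a≈b) (≈⇒∣ c≈d)) (regroup a b c d)
    where
    regroup : ∀ a b c d → a - b - (c - d) ≡ a - c - (b - d)
    regroup = solve-∀

  neg-cong : ∀ {a b} → a ≈ b → - a ≈ - b
  neg-cong {a} {b} a≈b = ∣⇒≈ (∣m⇒∣-m (≈⇒∣ a≈b)) (neg-minus a b)
    where
    neg-minus : ∀ a b → - (a - b) ≡ - a - - b
    neg-minus = solve-∀

  *-cong : ∀ {a b c d} → a ≈ b → c ≈ d → a *ℤ c ≈ b *ℤ d
  *-cong {a} {b} {c} {d} a≈b c≈d = ∣⇒≈ (∣m∣n⇒∣m+n (∣n⇒∣m*n c (≈⇒∣ a≈b)) (∣n⇒∣m*n b (≈⇒∣ c≈d))) (expand a b c d)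
    where
    expand : ∀ a b c d → c *ℤ (a - b) +ℤ b *ℤ (c - d) ≡ a *ℤ c - b *ℤ d
    expand = solve-∀

  ^-inverse : ∀ {a b} → a *ℤ b ≈ 1ℤ → ∀ j → a ^ j *ℤ b ^ j ≈ 1ℤ
  ^-inverse ab≈1 zero          = ≈-refl
  ^-inverse {a} {b} ab≈1 (suc j) =
    ≈-trans (≈-reflexive (*-interchange a (a ^ j) b (b ^ j))) (*-cong ab≈1 (^-inverse ab≈1 j))

  Δ^-cong-≈ : ∀ a j {f g : ℕ → ℤ} → (∀ z → f z ≈ g z) → ∀ z → Δ^ a j f z ≈ Δ^ a j g z
  Δ^-cong-≈ a zero    f≈g = f≈g
  Δ^-cong-≈ a (suc j) f≈g = Δ^-cong-≈ a j (λ z → minus-cong (f≈g z) (f≈g (a + z)))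

  residue : .{{NonZero q}} → ℤ → Fin q
  residue a = Fin.fromℕ< (n%ℕd<d a q)

  residue-≈ : .{{_ : NonZero q}} → ∀ a → + toℕ (residue a) ≈ a
  residue-≈ a = ∣⇒≈ (divides (- (a /ℕ q)) refl) (begin
    - (a /ℕ q) *ℤ + q                                ≡⟨ cancel (+ (a %ℕ q)) (a /ℕ q) (+ q) ⟨
    + (a %ℕ q) - (+ (a %ℕ q) +ℤ a /ℕ q *ℤ + q)       ≡⟨ cong₂ _-_ (cong +_ (toℕ-fromℕ< (n%ℕd<d a q))) (a≡a%ℕn+[a/ℕn]*n a q) ⟨
    + toℕ (residue a) - a                            ∎)
    where
    open ≡-Reasoning
    cancel : ∀ r k n → r - (r +ℤ k *ℤ n) ≡ - k *ℤ n
    cancel = solve-∀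

  private
    toℤ-Bézout : ∀ {x y u v} → 1 + y * u ≡ x * v → 1ℤ +ℤ + y *ℤ + u ≡ + x *ℤ + v
    toℤ-Bézout {x} {y} {u} {v} eq = begin
      1ℤ +ℤ + y *ℤ + u    ≡⟨ cong (1ℤ +ℤ_) (ℤₚ.pos-* y u) ⟨
      1ℤ +ℤ + (y * u)     ≡⟨ ℤₚ.pos-+ 1 (y * u) ⟨
      + (1 + y * u)       ≡⟨ cong +_ eq ⟩
      + (x * v)           ≡⟨ ℤₚ.pos-* x v ⟩
      + x *ℤ + v          ∎
      where open ≡-Reasoning

  coprime⇒invertible : ∀ {p} → Coprime p q → ∃ λ m → m *ℤ + p ≈ 1ℤ
  coprime⇒invertible {p} p⊥q with coprime-Bézout p⊥q
  ... | Bézout.+- x y 1+yq≡xp = + x , ∣⇒≈ (divides (+ y) refl) (begin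
    + y *ℤ + q                 ≡⟨ cancel (+ y *ℤ + q) ⟨
    1ℤ +ℤ + y *ℤ + q - 1ℤ      ≡⟨ cong (_- 1ℤ) (toℤ-Bézout {x} {y} {q} {p} 1+yq≡xp) ⟩
    + x *ℤ + p - 1ℤ            ∎)
    where
    open ≡-Reasoning
    cancel : ∀ k → 1ℤ +ℤ k - 1ℤ ≡ k
    cancel = solve-∀
  ... | Bézout.-+ x y 1+xp≡yq = - + x , ∣⇒≈ (divides (- + y) refl) (begin
    - + y *ℤ + q               ≡⟨ ℤₚ.neg-distribˡ-* (+ y) (+ q) ⟨
    - (+ y *ℤ + q)             ≡⟨ cong -_ (toℤ-Bézout {y} {x} {p} {q} 1+xp≡yq) ⟨
    - (1ℤ +ℤ + x *ℤ + p)       ≡⟨ rearrange (+ x) (+ p) ⟩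
    - + x *ℤ + p - 1ℤ          ∎)
    where
    open ≡-Reasoning
    rearrange : ∀ x p → - (1ℤ +ℤ x *ℤ p) ≡ - x *ℤ p - 1ℤ
    rearrange = solve-∀

sumOver-outside : ∀ {d} (S : Subset d) (x : Fin (suc d) → Fin 2) → sumOver (outside ∷ S) x ≡ sumOver S (x ∘ Fin.suc)
sumOver-outside {d} S x = cong sum (map-tabulate-suc {n = d} _)

sumOver-inside : ∀ {d} (S : Subset d) (x : Fin (suc d) → Fin 2) →
                 sumOver (inside ∷ S) x ≡ toℕ (x Fin.zero) + sumOver S (x ∘ Fin.suc)
sumOver-inside {d} S x = cong (λ xs → toℕ (x Fin.zero) + sum xs) (map-tabulate-suc {n = d} _)

prodAll-suc : ∀ {d} (x : Fin (suc d) → Fin 2) → prodAll x ≡ toℕ (x Fin.zero) * prodAll (x ∘ Fin.suc)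
prodAll-suc {d} x = cong (λ xs → toℕ (x Fin.zero) * product xs) (map-tabulate-suc {n = d} _)

prodAll-binary : ∀ {d} (x : Fin d → Fin 2) → prodAll x ≡ 0 ⊎ prodAll x ≡ 1
prodAll-binary {zero}  x = inj₂ refl
prodAll-binary {suc d} x rewrite prodAll-suc x with x Fin.zero
... | Fin.zero          = inj₁ refl
... | Fin.suc Fin.zero  = Sum.map (trans (*-identityˡ _)) (trans (*-identityˡ _)) (prodAll-binary (x ∘ Fin.suc))

shift-by-binary : ∀ {P} → P ≡ 0 ⊎ P ≡ 1 → (f : ℕ → ℤ) (a y : ℕ) → f (a * P + y) ≡ f y +ℤ + P *ℤ (- Δ a f y)
shift-by-binary (inj₁ refl) f a y = trans (cong (λ k → f (k + y)) (*-zeroʳ a)) (sym (ℤₚ.+-identityʳ (f y)))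
shift-by-binary (inj₂ refl) f a y = trans (cong (λ k → f (k + y)) (*-identityʳ a)) (one-step (f y) (f (a + y)))
  where
  one-step : ∀ u v → v ≡ u +ℤ 1ℤ *ℤ (- (u - v))
  one-step = solve-∀

alternatingSum : ∀ {d} (x : Fin d → Fin 2) (a : ℕ) (G : ℕ → ℤ) (y : ℕ) →
                 ΣS d (λ S → sign ∣ S ∣ *ℤ G (a * sumOver S x + y)) ≡ + prodAll x *ℤ Δ^ a d G y
alternatingSum {zero}  x a G y = trans (ℤₚ.+-identityʳ _) (cong (λ k → 1ℤ *ℤ G (k + y)) (*-zeroʳ a))
alternatingSum {suc d} x a G y = begin
  ΣS (suc d) F
    ≡⟨ sumOf-++-map (allSubsets d) (outside ∷_) (inside ∷_) F ⟩
  ΣS d (λ S → F (outside ∷ S) +ℤ F (inside ∷ S))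
    ≡⟨ sumOf-cong (allSubsets d) pair ⟩
  ΣS d (λ S → sign ∣ S ∣ *ℤ Δ (a * x₀) G (a * sumOver S x′ + y))
    ≡⟨ alternatingSum x′ a (Δ (a * x₀) G) y ⟩
  + prodAll x′ *ℤ Δ^ a d (Δ (a * x₀) G) y
    ≡⟨ peel (x Fin.zero) ⟩
  + (x₀ * prodAll x′) *ℤ Δ^ a (suc d) G y
    ≡⟨ cong (λ P → + P *ℤ Δ^ a (suc d) G y) (prodAll-suc x) ⟨
  + prodAll x *ℤ Δ^ a (suc d) G y
    ∎
  where
  open ≡-Reasoning
  x₀ : ℕ
  x₀ = toℕ (x Fin.zero)
  x′ : Fin d → Fin 2
  x′ = x ∘ Fin.suc

  F : Subset (suc d) → ℤ
  F S = sign ∣ S ∣ *ℤ G (a * sumOver S x + y)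

  pair : ∀ S → F (outside ∷ S) +ℤ F (inside ∷ S) ≡ sign ∣ S ∣ *ℤ Δ (a * x₀) G (a * sumOver S x′ + y)
  pair S = begin
    sign ∣ S ∣ *ℤ G (a * sumOver (outside ∷ S) x + y) +ℤ -1ℤ *ℤ sign ∣ S ∣ *ℤ G (a * sumOver (inside ∷ S) x + y)
      ≡⟨ cong₂ (λ u v → sign ∣ S ∣ *ℤ G (a * u + y) +ℤ -1ℤ *ℤ sign ∣ S ∣ *ℤ G v) (sumOver-outside S x) shifted ⟩
    sign ∣ S ∣ *ℤ G s +ℤ -1ℤ *ℤ sign ∣ S ∣ *ℤ G (a * x₀ + s)
      ≡⟨ factor (sign ∣ S ∣) (G s) (G (a * x₀ + s)) ⟩
    sign ∣ S ∣ *ℤ Δ (a * x₀) G s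
      ∎
    where
    s : ℕ
    s = a * sumOver S x′ + y
    shifted : a * sumOver (inside ∷ S) x + y ≡ a * x₀ + s
    shifted = begin
      a * sumOver (inside ∷ S) x + y   ≡⟨ cong (λ k → a * k + y) (sumOver-inside S x) ⟩
      a * (x₀ + sumOver S x′) + y      ≡⟨ cong (_+ y) (*-distribˡ-+ a x₀ _) ⟩
      a * x₀ + a * sumOver S x′ + y    ≡⟨ +-assoc (a * x₀) _ y ⟩
      a * x₀ + s                       ∎
    factor : ∀ σ u v → σ *ℤ u +ℤ -1ℤ *ℤ σ *ℤ v ≡ σ *ℤ (u - v)
    factor = solve-∀

  peel : (b : Fin 2) → + prodAll x′ *ℤ Δ^ a d (Δ (a * toℕ b) G) y ≡ + (toℕ b * prodAll x′) *ℤ Δ^ a (suc d) G y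
  peel Fin.zero = trans (cong (+ prodAll x′ *ℤ_) (Δ^-zero a d no-step y)) (ℤₚ.*-zeroʳ (+ prodAll x′))
    where
    no-step : ∀ w → Δ (a * 0) G w ≡ 0ℤ
    no-step w = trans (cong (λ k → G w - G (k + w)) (*-zeroʳ a)) (ℤₚ.+-inverseʳ (G w))
  peel (Fin.suc Fin.zero) = cong₂ (λ P D → + P *ℤ D) (sym (*-identityˡ (prodAll x′)))
                                  (Δ^-cong a d (λ w → cong (λ k → G w - G (k + w)) (*-identityʳ a)) y)

red-% : ∀ p .{{_ : NonZero p}} z → red p z ≡ z % p
red-% (suc k) z = refl

𝐛-≡ : ∀ {p z r} → red p z ≡ red p r → 𝐛 p z r ≡ 1ℤ
𝐛-≡ {p} {z} {r} eq with red p z ≟ red p r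
... | yes _  = refl
... | no neq = ⊥-elim (neq eq)

𝐛-≢ : ∀ {p z r} → red p z ≢ red p r → 𝐛 p z r ≡ 0ℤ
𝐛-≢ {p} {z} {r} neq with red p z ≟ red p r
... | yes eq = ⊥-elim (neq eq)
... | no _   = refl

𝐛-congˡ : ∀ {p z z′ r} → red p z′ ≡ red p z → 𝐛 p z′ r ≡ 𝐛 p z r
𝐛-congˡ {p} {z} {z′} {r} eq with red p z ≟ red p r
... | yes eq′ = 𝐛-≡ (trans eq eq′)
... | no neq  = 𝐛-≢ (neq ∘ trans (sym eq))

module _ (p : ℕ) .{{_ : NonZero p}} where

  𝐛-periodic : ∀ r → Periodic p (λ z → 𝐛 p z r)
  𝐛-periodic r z = 𝐛-congˡ (begin
    red p (p + z)    ≡⟨ red-% p (p + z) ⟩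
    (p + z) % p      ≡⟨ cong (_% p) (+-comm p z) ⟩
    (z + p) % p      ≡⟨ [m+n]%n≡m%n z p ⟩
    z % p            ≡⟨ red-% p z ⟨
    red p z          ∎)
    where open ≡-Reasoning

  red-toℕ : (r : Fin p) → red p (toℕ r) ≡ toℕ r
  red-toℕ r = trans (red-% p (toℕ r)) (m<n⇒m%n≡m (toℕ<n r))

  red-mod : ∀ z → red p z ≡ toℕ (z mod p)
  red-mod z = trans (red-% p z) (sym (toℕ-fromℕ< (m%n<n z p)))

  sumOf-𝐛 : (w : Fin p → ℤ) (z : ℕ) → sumOf (allFin p) (λ r → w r *ℤ 𝐛 p z (toℕ r)) ≡ w (z mod p)
  sumOf-𝐛 w z = trans (sumOf-allFin-single _ (z mod p) off) on
    where
    off : ∀ r → r ≢ z mod p → w r *ℤ 𝐛 p z (toℕ r) ≡ 0ℤ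
    off r r≢z = trans (cong (w r *ℤ_) (𝐛-≢ (r≢z ∘ sym ∘ toℕ-injective ∘ same-residue))) (ℤₚ.*-zeroʳ (w r))
      where
      same-residue : red p z ≡ red p (toℕ r) → toℕ (z mod p) ≡ toℕ r
      same-residue eq = trans (sym (red-mod z)) (trans eq (red-toℕ r))
    on : w (z mod p) *ℤ 𝐛 p z (toℕ (z mod p)) ≡ w (z mod p)
    on = trans (cong (w (z mod p) *ℤ_) (𝐛-≡ (trans (red-mod z) (sym (red-toℕ (z mod p)))))) (ℤₚ.*-identityʳ _)

distinctPrimes⇒coprime : ∀ {p q} → Prime p → Prime q → p ≢ q → Coprime p q
distinctPrimes⇒coprime {p} {q} p-prime q-prime p≢q with <-cmp p q
... | tri< p<q _ _ = Coprimality.sym (prime⇒coprime q-prime {{prime⇒nonZero p-prime}} p<q)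
... | tri≈ _ p≡q _ = ⊥-elim (p≢q p≡q)
... | tri> _ _ q<p = prime⇒coprime p-prime {{prime⇒nonZero q-prime}} q<p

module Construction (p q : ℕ) .{{_ : NonZero p}} .{{_ : NonZero q}}
                    (m : ℤ) (γ t e : ℕ) where

  open Congruence q

  h : ℕ → ℤ
  h z = 𝐛 p z t

  -- c (-p)^e = -((-m)(-p))^e ≡ -1 (mod q) once m p ≡ 1.
  c : ℤ
  c = - (- m) ^ e

  g : ℕ → ℤ
  g z = c *ℤ weightedOrbitSum^ p γ e h z

  β : Fin p → Fin q
  β r = residue (g (toℕ r))

  B : ℕ → ℤ
  B z = sumOf (allFin p) (λ r → + toℕ (β r) *ℤ 𝐛 p z (toℕ r))

  B≈g : ∀ z → B z ≈ g z
  B≈g z = begin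
    B z                      ≡⟨ sumOf-𝐛 p (λ r → + toℕ (β r)) z ⟩
    + toℕ (β (z mod p))      ≈⟨ residue-≈ (g (toℕ (z mod p))) ⟩
    g (toℕ (z mod p))        ≡⟨ cong g (toℕ-fromℕ< (m%n<n z p)) ⟩
    g (z % p)                ≡⟨ periodic-% g-periodic z ⟩
    g z                      ∎
    where
    open SetoidReasoning ≈-setoid
    g-periodic : Periodic p g
    g-periodic z = cong (c *ℤ_) (weightedOrbitSum^-periodic p γ e (𝐛-periodic p t) z)

  module _ (m*p≈1 : m *ℤ + p ≈ 1ℤ) where

    Δ^B≈-Δh : ∀ z → Δ^ γ (suc e) B z ≈ - Δ γ h z
    Δ^B≈-Δh z = begin
      Δ^ γ (suc e) B z                                             ≈⟨ Δ^-cong-≈ γ (suc e) B≈g z ⟩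
      Δ^ γ (suc e) g z                                             ≡⟨ Δ^-*ˡ γ (suc e) c (weightedOrbitSum^ p γ e h) z ⟩
      c *ℤ Δ^ γ (suc e) (weightedOrbitSum^ p γ e h) z              ≡⟨ cong (c *ℤ_) (Δ^-weightedOrbitSum^ p γ e (𝐛-periodic p t) z) ⟩
      - (- m) ^ e *ℤ ((- + p) ^ e *ℤ Δ γ h z)                      ≡⟨ regroup ((- m) ^ e) ((- + p) ^ e) (Δ γ h z) ⟩
      - ((- m) ^ e *ℤ (- + p) ^ e *ℤ Δ γ h z)                      ≈⟨ neg-cong (*-cong (^-inverse -m*-p≈1 e) ≈-refl) ⟩
      - (1ℤ *ℤ Δ γ h z)                                            ≡⟨ cong -_ (ℤₚ.*-identityˡ _) ⟩
      - Δ γ h z                                                    ∎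
      where
      open SetoidReasoning ≈-setoid
      regroup : ∀ u v w → - u *ℤ (v *ℤ w) ≡ - (u *ℤ v *ℤ w)
      regroup = solve-∀
      neg-cancel : ∀ u v → - u *ℤ - v ≡ u *ℤ v
      neg-cancel = solve-∀
      -m*-p≈1 : - m *ℤ - + p ≈ 1ℤ
      -m*-p≈1 = ≈-trans (≈-reflexive (neg-cancel m (+ p))) m*p≈1

    correct : (x : Fin (suc e) → Fin 2) (y : ℕ) →
      h (γ * prodAll x + y) ≈
      h y +ℤ Σ[ p ] (λ r → + toℕ (β r) *ℤ ΣS (suc e) (λ S → sign ∣ S ∣ *ℤ 𝐛 p (γ * sumOver S x + y) (toℕ r)))
    correct x y = begin
      h (γ * prodAll x + y)
        ≡⟨ shift-by-binary (prodAll-binary x) h γ y ⟩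
      h y +ℤ + prodAll x *ℤ (- Δ γ h y)
        ≈⟨ +-cong (≈-refl {h y}) (*-cong (≈-refl {+ prodAll x}) (Δ^B≈-Δh y)) ⟨
      h y +ℤ + prodAll x *ℤ Δ^ γ (suc e) B y
        ≡⟨ cong (h y +ℤ_) (alternatingSum x γ B y) ⟨
      h y +ℤ ΣS (suc e) (λ S → sign ∣ S ∣ *ℤ B (γ * sumOver S x + y))
        ≡⟨ cong (h y +ℤ_) (sumOf-interchange (allFin p) (allSubsets (suc e)) (λ r → + toℕ (β r)) (λ S → sign ∣ S ∣) K) ⟨
      h y +ℤ Σ[ p ] (λ r → + toℕ (β r) *ℤ ΣS (suc e) (λ S → sign ∣ S ∣ *ℤ 𝐛 p (γ * sumOver S x + y) (toℕ r)))
        ∎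
      where
      open SetoidReasoning ≈-setoid
      K : Fin p → Subset (suc e) → ℤ
      K r S = 𝐛 p (γ * sumOver S x + y) (toℕ r)

lemma10 : (p q d : ℕ) → Prime p → Prime q → p ≢ q → d ≥ 1 →
    (γ : Fin p) → toℕ γ ≢ 0 → (t : Fin p) →
    ∃ λ (β : Fin p → Fin q) →
      (x : Fin d → Fin 2) → (y : Fin p) →
        𝐛 p (toℕ γ * prodAll x + toℕ y) (toℕ t)
        ≡[mod q ]
        (𝐛 p (toℕ y) (toℕ t)
          +ℤ Σ[ p ] (λ r → (+ toℕ (β r)) *ℤ
               ΣS d (λ S → sign ∣ S ∣ *ℤ 𝐛 p (toℕ γ * sumOver S x + toℕ y) (toℕ r))))
lemma10 p q zero    _ _ _ () _ _ _
lemma10 p q (suc e) p-prime q-prime p≢q _ γ _ t = β , λ x y → ≈⇒≡[mod] (correct (proj₂ inverse) x (toℕ y))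
  where
  instance
    p-nonZero : NonZero p
    p-nonZero = prime⇒nonZero p-prime
    q-nonZero : NonZero q
    q-nonZero = prime⇒nonZero q-prime
  open Congruence q
  inverse : ∃ λ m → m *ℤ + p ≈ 1ℤ
  inverse = coprime⇒invertible (distinctPrimes⇒coprime p-prime q-prime p≢q)
  open Construction p q (proj₁ inverse) (toℕ γ) (toℕ t) e
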